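{- The binary relation $<$ on $\mathrm{Ord}$ is well-founded.
   Context: The setting is constructive. A binary relation $<$ on a set $X$ is well-founded if for any family of sets $(E_x)_{x\in X}$ and any construction $\gamma$ which from $a\in X$ and $\varphi\in\prod_{x\in X,x<a}E_x$ produces $\gamma(a,\varphi)\in E_a$, there exists a unique $\Phi\in\prod_{x\in X}E_x$ with $\Phi(a)=\gamma(a,\Phi|_{\{x\in X:x<a\}})$ for all $a\in X$ (in particular, every $<$-hereditary property holds on all of $X$). Let $\mathfrak F$ be a set of index sets containing $\mathbb N$ and every $\mathbb N_k=\{n\in\mathbb N:n<k\}$, closed (up to isomorphism) under finitely enumerated subsets, sets of finitely enumerated subsets, and disjoint unions indexed by elements of $\mathfrak F$. The set $\mathrm{ord}=\mathrm{ord}_{\mathfrak F}$ is defined inductively: a distinguished element $\underline 0$, and for every $I\in\mathfrak F$ and family $(\alpha_i)_{i\in I}$ in $\mathrm{ord}$ an element $\mathrm S(\alpha_i)_{i\in I}$. For $\alpha=\mathrm S(\alpha_i)_{i\in I}$, $\mathrm{In}_\alpha=I$; by convention $\mathrm{In}_{\underline0}=\emptyset$. For a finite list $F\subseteq_f\mathrm{In}_\alpha$, $\alpha_F$ is the list of the $\alpha_i$, $i\in F$. By simultaneous induction ($m\ge1$): $\alpha\le\beta^1,\dots,\beta^m$ means $\alpha_i<\beta^1,\dots,\beta^m$ for all $i\in\mathrm{In}_\alpha$; $\alpha<\beta^1,\dots,\beta^m$ means there exist $F_k\subseteq_f\mathrm{In}_{\beta^k}$, not all empty, with $\alpha\le\beta^1_{F_1},\dots,\beta^m_{F_m}$;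 $m=1$ gives binary $\le,<$. $\mathrm{Ord}$ is the quotient of $\mathrm{ord}$ by the equivalence relation $\alpha\le\beta$ and $\beta\le\alpha$, to which $<$ descends. -}

module Defs where

open import Data.Nat using (ℕ) renaming (_<_ to _<ℕ_)
open import Data.Fin using (Fin)
open import Data.Product using (Σ; _×_; _,_)
open import Data.Sum using (_⊎_)
open import Data.Empty using (⊥)
open import Data.Unit using (⊤)
open import Data.List using (List; []; _∷_; map; _++_)
open import Data.List.Membership.Propositional using (_∈_)
open import Function.Bundles using (_↔_; _↣_; _⇔_)
open import Relation.Binary.PropositionalEquality using (_≡_)

-- The set 𝔉 of index sets, presented as a universe (Code, El):
-- the index sets are the types  El c  for  c : Code.
-- Closure properties are "up to isomorphism" (_↔_).

ℕ< : ℕ → Set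
ℕ< k = Σ ℕ (λ n → n <ℕ k)

record IndexSets : Set₁ where
  field
    Code : Set
    El   : Code → Set
    hasℕ  : Σ Code (λ c → El c ↔ ℕ)
    hasℕ< : (k : ℕ) → Σ Code (λ c → El c ↔ ℕ< k)
    -- closed under finitely enumerated subsets: a subset S of El c which is
    -- finitely enumerated (the image of some Fin n, embedded in El c)
    finSub : (c : Code) (S : Set) (n : ℕ) (e : Fin n → S) →
             ((s : S) → Σ (Fin n) (λ j → e j ≡ s)) →
             S ↣ El c →
             Σ Code (λ d → El d ↔ S)
    -- closed under the set of finitely enumerated subsets of El c:
    -- any T which is (List (El c)) quotiented by "same elements"
    finSubs : (c : Code) (T : Set) (q : List (El c) → T) →
              ((t : T) → Σ (List (El c)) (λ l → q l ≡ t)) →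
              ((l l′ : List (El c)) →
                 (q l ≡ q l′) ⇔ ((i : El c) → (i ∈ l) ⇔ (i ∈ l′))) →
              Σ Code (λ d → El d ↔ T)
    disjUnion : (c : Code) (f : El c → Code) →
                Σ Code (λ d → El d ↔ Σ (El c) (λ i → El (f i)))

module Ordinals (𝔉 : IndexSets) where
  open IndexSets 𝔉

  data ord : Set where
    0̲ : ord
    S  : (c : Code) → (El c → ord) → ord

  In : ord → Set
  In 0̲       = ⊥
  In (S c _) = El c

  comp : (α : ord) → In α → ord
  comp (S c f) i = f i

  Sel : List ord → Set
  Sel []       = ⊤
  Sel (β ∷ βs) = List (In β) × Sel βs

  pick : (βs : List ord) → Sel βs → List ord
  pick []       _        = []
  pick (β ∷ βs) (F , Fs) = map (comp β) F ++ pick βs Fs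

  NonEmpty : {A : Set} → List A → Set
  NonEmpty []      = ⊥
  NonEmpty (_ ∷ _) = ⊤

  NotAllEmpty : (βs : List ord) → Sel βs → Set
  NotAllEmpty []       _        = ⊥
  NotAllEmpty (β ∷ βs) (F , Fs) = NonEmpty F ⊎ NotAllEmpty βs Fs

  -- α < β^1,…,β^m  (by recursion on α; α ≤ … is unfolded inline)
  _<ₗ_ : ord → List ord → Set
  0̲     <ₗ βs = Σ (Sel βs) (λ Fs → NotAllEmpty βs Fs × ((i : ⊥) → ⊥))
  S c f <ₗ βs = Σ (Sel βs) (λ Fs → NotAllEmpty βs Fs ×
                                   ((i : El c) → f i <ₗ pick βs Fs))

  _≤ₗ_ : ord → List ord → Set
  α ≤ₗ βs = (i : In α) → comp α i <ₗ βs

  _≤_ : ord → ord → Set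
  α ≤ β = α ≤ₗ (β ∷ [])

  _<_ : ord → ord → Set
  α < β = α <ₗ (β ∷ [])

  -- the equivalence relation whose quotient is Ord
  _≈_ : ord → ord → Set
  α ≈ β = (α ≤ β) × (β ≤ α)

{-# OPTIONS --safe #-}
-- A list of ordinals is accessible if every list made of a nonempty finite
-- selection of components of its members is accessible.  Accessibility of
-- lists is closed under concatenation, so every list is accessible by
-- structural induction on ord.  If α < γs, say α ≤ δs for a selection δs of
-- γs, then every α′ < α satisfies α′ < δs, because < composes with ≤.  Hence
-- everything below an accessible list is accessible for <, and α < β is
-- α < (β ∷ []).
module Submission where

open import Defs
open import Induction.WellFounded using (WellFounded; Acc; acc)
open import Data.List using (List; []; _∷_; map; _++_)
open import Data.List.Properties using (++-assoc; ++-identityʳ)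
open import Data.List.Membership.Propositional using (_∈_)
open import Data.List.Membership.Propositional.Properties using (∈-++⁻)
open import Data.List.Relation.Unary.Any using (here; there)
open import Data.List.Relation.Unary.All as All using (All; []; _∷_)
import Data.List.Relation.Unary.All.Properties as Allₚ
open import Data.List.Relation.Binary.Subset.Propositional using (_⊆_)
open import Data.List.Relation.Binary.Subset.Propositional.Properties as ⊆
  using (⊆-trans; xs⊆xs++ys; xs⊆ys++xs)
open import Data.Product using (Σ; _×_; _,_; proj₁; proj₂)
open import Data.Sum using (_⊎_; inj₁; inj₂; [_,_]′)
open import Data.Unit using (tt)
open import Function using (_∘_)
open import Relation.Binary.PropositionalEquality using (_≡_; refl; sym; subst)

++-⊆ : {A : Set} {xs ys zs : List A} → xs ⊆ zs → ys ⊆ zs → xs ++ ys ⊆ zs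
++-⊆ {xs = xs} xs⊆zs ys⊆zs v∈ = [ xs⊆zs , ys⊆zs ]′ (∈-++⁻ xs v∈)

module OrdinalOrder (𝔉 : IndexSets) where
  open IndexSets 𝔉
  open Ordinals 𝔉

  emptySel : (βs : List ord) → Sel βs
  emptySel []       = tt
  emptySel (β ∷ βs) = [] , emptySel βs

  _⊕_ : {βs : List ord} → Sel βs → Sel βs → Sel βs
  _⊕_ {[]}    _        _        = tt
  _⊕_ {_ ∷ _} (F , Fs) (G , Gs) = F ++ G , Fs ⊕ Gs

  ⊕-notAllEmptyˡ : (βs : List ord) (Fs Gs : Sel βs) →
                   NotAllEmpty βs Fs → NotAllEmpty βs (Fs ⊕ Gs)
  ⊕-notAllEmptyˡ (_ ∷ _)  (_ ∷ _ , _)  _        (inj₁ _) = inj₁ tt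
  ⊕-notAllEmptyˡ (_ ∷ βs) (_ , Fs)     (_ , Gs) (inj₂ n) = inj₂ (⊕-notAllEmptyˡ βs Fs Gs n)

  ⊕-notAllEmptyʳ : (βs : List ord) (Fs Gs : Sel βs) →
                   NotAllEmpty βs Gs → NotAllEmpty βs (Fs ⊕ Gs)
  ⊕-notAllEmptyʳ (_ ∷ _)  ([] , _)    _        (inj₁ n) = inj₁ n
  ⊕-notAllEmptyʳ (_ ∷ _)  (_ ∷ _ , _) _        (inj₁ _) = inj₁ tt
  ⊕-notAllEmptyʳ (_ ∷ βs) (_ , Fs)    (_ , Gs) (inj₂ n) = inj₂ (⊕-notAllEmptyʳ βs Fs Gs n)

  pick-⊕ˡ : (βs : List ord) (Fs Gs : Sel βs) → pick βs Fs ⊆ pick βs (Fs ⊕ Gs)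
  pick-⊕ˡ []       _        _        = λ ()
  pick-⊕ˡ (β ∷ βs) (F , Fs) (G , Gs) =
    ⊆.++⁺ (⊆.map⁺ (comp β) (xs⊆xs++ys F G)) (pick-⊕ˡ βs Fs Gs)

  pick-⊕ʳ : (βs : List ord) (Fs Gs : Sel βs) → pick βs Gs ⊆ pick βs (Fs ⊕ Gs)
  pick-⊕ʳ []       _        _        = λ ()
  pick-⊕ʳ (β ∷ βs) (F , Fs) (G , Gs) =
    ⊆.++⁺ (⊆.map⁺ (comp β) (xs⊆ys++xs G F)) (pick-⊕ʳ βs Fs Gs)

  selectAt : {β : ord} {βs : List ord} → β ∈ βs → List (In β) → Sel βs
  selectAt {βs = _ ∷ βs} (here refl) F = F , emptySel βs
  selectAt               (there p)   F = [] , selectAt p F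

  selectAt-notAllEmpty : {β : ord} {βs : List ord} (p : β ∈ βs) (F : List (In β)) →
                         NonEmpty F → NotAllEmpty βs (selectAt p F)
  selectAt-notAllEmpty (here refl) F ne = inj₁ ne
  selectAt-notAllEmpty (there p)   F ne = inj₂ (selectAt-notAllEmpty p F ne)

  pick-selectAt : {β : ord} {βs : List ord} (p : β ∈ βs) (F : List (In β)) →
                  map (comp β) F ⊆ pick βs (selectAt p F)
  pick-selectAt (here refl) F = xs⊆xs++ys _ _
  pick-selectAt (there p)   F = pick-selectAt p F

  Sel-⊆ : (βs γs : List ord) → βs ⊆ γs → (Fs : Sel βs) →
          Σ (Sel γs) (λ Gs → (NotAllEmpty βs Fs → NotAllEmpty γs Gs) × pick βs Fs ⊆ pick γs Gs)
  Sel-⊆ []       γs _     _        = emptySel γs , (λ ()) , (λ ())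
  Sel-⊆ (β ∷ βs) γs βs⊆γs (F , Fs) with Sel-⊆ βs γs (βs⊆γs ∘ there) Fs
  ... | Gs , notAllEmpty , pick⊆ =
    H ⊕ Gs ,
    [ ⊕-notAllEmptyˡ γs H Gs ∘ selectAt-notAllEmpty p F , ⊕-notAllEmptyʳ γs H Gs ∘ notAllEmpty ]′ ,
    ++-⊆ (⊆-trans (pick-selectAt p F) (pick-⊕ˡ γs H Gs)) (⊆-trans pick⊆ (pick-⊕ʳ γs H Gs))
    where
      p : β ∈ γs
      p = βs⊆γs (here refl)
      H : Sel γs
      H = selectAt p F

  pick-nonEmpty : (βs : List ord) (Fs : Sel βs) → NotAllEmpty βs Fs → NonEmpty (pick βs Fs)
  pick-nonEmpty (_ ∷ _)  (_ ∷ _ , _) _        = tt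
  pick-nonEmpty (_ ∷ βs) ([] , Fs)   (inj₂ n) = pick-nonEmpty βs Fs n

  <ₗ-unfold : (α : ord) (βs : List ord) → α <ₗ βs →
              Σ (Sel βs) (λ Fs → NotAllEmpty βs Fs × α ≤ₗ pick βs Fs)
  <ₗ-unfold 0̲       βs (Fs , ne , _) = Fs , ne , λ ()
  <ₗ-unfold (S c f) βs α<βs         = α<βs

  <ₗ-fold : (α : ord) (βs : List ord) (Fs : Sel βs) →
            NotAllEmpty βs Fs → α ≤ₗ pick βs Fs → α <ₗ βs
  <ₗ-fold 0̲       βs Fs ne _   = Fs , ne , λ ()
  <ₗ-fold (S c f) βs Fs ne α≤ = Fs , ne , α≤

  mutual
    <ₗ-mono : (α : ord) {βs γs : List ord} → βs ⊆ γs → α <ₗ βs → α <ₗ γs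
    <ₗ-mono α {βs} {γs} βs⊆γs α<βs with <ₗ-unfold α βs α<βs
    ... | Fs , ne , α≤ with Sel-⊆ βs γs βs⊆γs Fs
    ... | Gs , ne′ , pick⊆ = <ₗ-fold α γs Gs (ne′ ne) (≤ₗ-mono α pick⊆ α≤)

    ≤ₗ-mono : (α : ord) {βs γs : List ord} → βs ⊆ γs → α ≤ₗ βs → α ≤ₗ γs
    ≤ₗ-mono (S c f) βs⊆γs α≤ i = <ₗ-mono (f i) βs⊆γs (α≤ i)

  All-≤ₗ⇒All-<ₗ-pick : {βs γs : List ord} → All (_≤ₗ γs) βs →
                       (Fs : Sel βs) → All (_<ₗ γs) (pick βs Fs)
  All-≤ₗ⇒All-<ₗ-pick []         _        = []
  All-≤ₗ⇒All-<ₗ-pick (β≤ ∷ βs≤) (F , Fs) =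
    Allₚ.++⁺ (Allₚ.map⁺ (All.tabulate λ {i} _ → β≤ i)) (All-≤ₗ⇒All-<ₗ-pick βs≤ Fs)

  All-<ₗ⇒common-selection : {ws : List ord} (γs : List ord) → All (_<ₗ γs) ws →
    Σ (Sel γs) (λ Gs → (NonEmpty ws → NotAllEmpty γs Gs) × All (_≤ₗ pick γs Gs) ws)
  All-<ₗ⇒common-selection γs [] = emptySel γs , (λ ()) , []
  All-<ₗ⇒common-selection {w ∷ _} γs (w<γs ∷ ws<γs)
    with <ₗ-unfold w γs w<γs | All-<ₗ⇒common-selection γs ws<γs
  ... | Fs , ne , w≤ | Gs , _ , ws≤ =
    Fs ⊕ Gs ,
    (λ _ → ⊕-notAllEmptyˡ γs Fs Gs ne) ,
    ≤ₗ-mono w (pick-⊕ˡ γs Fs Gs) w≤ ∷ All.map (λ {v} → ≤ₗ-mono v (pick-⊕ʳ γs Fs Gs)) ws≤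

  mutual
    <ₗ-≤ₗ-trans : (α : ord) (βs γs : List ord) → α <ₗ βs → All (_≤ₗ γs) βs → α <ₗ γs
    <ₗ-≤ₗ-trans α βs γs α<βs βs≤γs with <ₗ-unfold α βs α<βs
    ... | Fs , ne , α≤
        with All-<ₗ⇒common-selection γs (All-≤ₗ⇒All-<ₗ-pick βs≤γs Fs)
    ... | Gs , ne′ , bound =
      <ₗ-fold α γs Gs (ne′ (pick-nonEmpty βs Fs ne)) (≤ₗ-trans α (pick βs Fs) (pick γs Gs) α≤ bound)

    ≤ₗ-trans : (α : ord) (βs γs : List ord) → α ≤ₗ βs → All (_≤ₗ γs) βs → α ≤ₗ γs
    ≤ₗ-trans (S c f) βs γs α≤βs βs≤γs i = <ₗ-≤ₗ-trans (f i) βs γs (α≤βs i) βs≤γs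

  data _◁_ : List ord → List ord → Set where
    selection : {βs : List ord} (Fs : Sel βs) → NotAllEmpty βs Fs → pick βs Fs ◁ βs

  []-acc : Acc _◁_ []
  []-acc = acc λ { (selection _ ()) }

  splitSel : (βs γs : List ord) → Sel (βs ++ γs) → Sel βs × Sel γs
  splitSel []       γs Fs       = tt , Fs
  splitSel (β ∷ βs) γs (F , Fs) = (F , proj₁ (splitSel βs γs Fs)) , proj₂ (splitSel βs γs Fs)

  pick-++ : (βs γs : List ord) (Fs : Sel (βs ++ γs)) →
            pick (βs ++ γs) Fs ≡ pick βs (proj₁ (splitSel βs γs Fs)) ++ pick γs (proj₂ (splitSel βs γs Fs))
  pick-++ []       γs Fs = refl
  pick-++ (β ∷ βs) γs (F , Fs) rewrite pick-++ βs γs Fs = sym (++-assoc (map (comp β) F) _ _)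

  notAllEmpty? : (βs : List ord) (Fs : Sel βs) → NotAllEmpty βs Fs ⊎ pick βs Fs ≡ []
  notAllEmpty? []       _           = inj₂ refl
  notAllEmpty? (_ ∷ _)  (_ ∷ _ , _) = inj₁ (inj₁ tt)
  notAllEmpty? (_ ∷ βs) ([] , Fs) with notAllEmpty? βs Fs
  ... | inj₁ n = inj₁ (inj₂ n)
  ... | inj₂ e = inj₂ e

  ++-acc : (βs γs : List ord) → Acc _◁_ βs → Acc _◁_ γs → Acc _◁_ (βs ++ γs)
  ++-acc βs γs (acc rsβ) (acc rsγ) = acc λ { (selection Fs _) →
      subst (Acc _◁_) (sym (pick-++ βs γs Fs))
        (parts (notAllEmpty? βs (proj₁ (splitSel βs γs Fs))) (notAllEmpty? γs (proj₂ (splitSel βs γs Fs)))) }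
    where
      parts : {Fβ : Sel βs} {Fγ : Sel γs} →
              NotAllEmpty βs Fβ ⊎ pick βs Fβ ≡ [] → NotAllEmpty γs Fγ ⊎ pick γs Fγ ≡ [] →
              Acc _◁_ (pick βs Fβ ++ pick γs Fγ)
      parts {Fβ} {Fγ} (inj₁ nβ) (inj₁ nγ) =
        ++-acc (pick βs Fβ) (pick γs Fγ) (rsβ (selection Fβ nβ)) (rsγ (selection Fγ nγ))
      parts {Fβ} {Fγ} (inj₁ nβ) (inj₂ eγ) rewrite eγ | ++-identityʳ (pick βs Fβ) = rsβ (selection Fβ nβ)
      parts {Fβ} {Fγ} (inj₂ eβ) (inj₁ nγ) rewrite eβ = rsγ (selection Fγ nγ)
      parts           (inj₂ eβ) (inj₂ eγ) rewrite eβ | eγ = []-acc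

  All-acc : (βs : List ord) → All (λ β → Acc _◁_ (β ∷ [])) βs → Acc _◁_ βs
  All-acc []       []         = []-acc
  All-acc (β ∷ βs) (a ∷ accs) = ++-acc (β ∷ []) βs a (All-acc βs accs)

  [-]-acc : (β : ord) → Acc _◁_ (β ∷ [])
  [-]-acc 0̲       = acc λ { (selection ([] , _) (inj₁ ())) ; (selection ([] , _) (inj₂ ())) }
  [-]-acc (S c f) = acc λ { (selection (F , _) _) →
    All-acc (map f F ++ []) (Allₚ.++⁺ (Allₚ.map⁺ (All.tabulate λ {i} _ → [-]-acc (f i))) []) }

  ◁-wellFounded : WellFounded _◁_
  ◁-wellFounded βs = All-acc βs (All.tabulate λ {β} _ → [-]-acc β)

  <ₗ-acc : {α : ord} (γs : List ord) → Acc _◁_ γs → α <ₗ γs → Acc _<_ α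
  <ₗ-acc {α} γs (acc rs) α<γs with <ₗ-unfold α γs α<γs
  ... | Fs , ne , α≤ = acc λ {α′} α′<α →
    <ₗ-acc (pick γs Fs) (rs (selection Fs ne)) (<ₗ-≤ₗ-trans α′ (α ∷ []) (pick γs Fs) α′<α (α≤ ∷ []))

  <-wellFounded : WellFounded _<_
  <-wellFounded β = acc (<ₗ-acc (β ∷ []) (◁-wellFounded (β ∷ [])))

proposition4p11 : (𝔉 : IndexSets) → WellFounded (Ordinals._<_ 𝔉)
proposition4p11 = OrdinalOrder.<-wellFounded
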